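{- Let $n\ge1$ and let $A$ be a finite alphabet. To each tableau $T=(a_{ij})\in A^{n\times n}$ associate the vertex-colored hypergraph $H_T$ on the vertex set $V=\{v_{ij}:1\le i,j\le n\}$ with coloring $\chi_T(v_{ij})=a_{ij}$. If $T\sim_{\mathbf c}T'$, then the colored hypergraphs $H_T$ and $H_{T'}$ are isomorphic.
   Context: The hypergraph has two families of blocks. The row blocks are $L=\{\{v_{ij}:1\le j\le n\}:1\le i\le n\}$. The diagonal blocks are $P=\{\{v_{\pi(i)i}:1\le i\le n\}:\pi\in S_n\}$. The vertices of each block are linearly ordered by their second index. For a vertex coloring $\chi$, $\chi(L)$ (resp. $\chi(P)$) denotes the set of color sequences read along the row blocks (resp. diagonal blocks) in this order. Thus, for the tableau, $\chi(L)$ is the set of row-words and $\chi(P)$ is the permanent. Two colorings $\chi,\chi'$ (colored hypergraphs) are isomorphic if there is a bijection $\lambda:\chi(L)\cup\chi(P)\to\chi'(L)\cup\chi'(P)$ whose restriction to $\chi(L)\cap\chi(P)$ is a bijection onto $\chi'(L)\cap\chi'(P)$. $T'\sim_{\mathbf c}T$ iff $T'$ is obtained from $T$ by a finite sequence of the following operations: permuting rows, permuting columns, and applying a bijection of $A$ to all entries of a single column. -}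

module Defs where

open import Data.Nat using (ℕ)
open import Data.Fin using (Fin; _≟_)
open import Data.Fin.Permutation using (Permutation′; _⟨$⟩ʳ_)
open import Data.Vec using (Vec; tabulate)
open import Data.Product using (Σ; ∃; ∃-syntax; _×_; _,_)
open import Data.Sum using (_⊎_)
open import Function.Bundles using (_↔_; Inverse)
open import Relation.Nullary using (yes; no)
open import Relation.Binary.PropositionalEquality using (_≡_)
open import Relation.Binary.Construct.Closure.ReflexiveTransitive using (Star)

IsFinite : Set → Set
IsFinite A = Σ ℕ λ k → A ↔ Fin k

-- Tableau T = (a_ij), T i j = a_ij (i = row index, j = column index).
Tableau : Set → ℕ → Set
Tableau A n = Fin n → Fin n → A

module _ {A : Set} {n : ℕ} where

  -- color sequence along the row block {v_ij : j}, ordered by j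
  rowWord : Tableau A n → Fin n → Vec A n
  rowWord T i = tabulate (λ j → T i j)

  -- color sequence along the diagonal block {v_π(i) i : i}, ordered by i
  diagWord : Tableau A n → Permutation′ n → Vec A n
  diagWord T π = tabulate (λ i → T (π ⟨$⟩ʳ i) i)

  InL : Tableau A n → Vec A n → Set
  InL T w = ∃[ i ] rowWord T i ≡ w

  InP : Tableau A n → Vec A n → Set
  InP T w = ∃[ π ] diagWord T π ≡ w

  InU : Tableau A n → Vec A n → Set
  InU T w = InL T w ⊎ InP T w

  InI : Tableau A n → Vec A n → Set
  InI T w = InL T w × InP T w

  -- Colored hypergraphs H_T and H_T' are isomorphic: there is a map λ which
  -- restricts to a bijection χ_T(L)∪χ_T(P) → χ_T'(L)∪χ_T'(P), and whose
  -- restriction to χ_T(L)∩χ_T(P) is a bijection onto χ_T'(L)∩χ_T'(P).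
  ColoredIso : Tableau A n → Tableau A n → Set
  ColoredIso T T' = Σ (Vec A n → Vec A n) λ f →
      (∀ w → InU T w → InU T' (f w))
    × (∀ w v → InU T w → InU T v → f w ≡ f v → w ≡ v)
    × (∀ w' → InU T' w' → ∃[ w ] (InU T w × f w ≡ w'))
    × (∀ w → InI T w → InI T' (f w))
    × (∀ w' → InI T' w' → ∃[ w ] (InI T w × f w ≡ w'))

  mapColumn : Fin n → (A ↔ A) → Tableau A n → Tableau A n
  mapColumn j₀ g T i j with j ≟ j₀
  ... | yes _ = Inverse.to g (T i j)
  ... | no _  = T i j

  data Step (T : Tableau A n) (T' : Tableau A n) : Set where
    permRows : (σ : Permutation′ n) →
               (∀ i j → T' i j ≡ T (σ ⟨$⟩ʳ i) j) → Step T T'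
    permCols : (σ : Permutation′ n) →
               (∀ i j → T' i j ≡ T i (σ ⟨$⟩ʳ j)) → Step T T'
    colBij   : (j₀ : Fin n) (g : A ↔ A) →
               (∀ i j → T' i j ≡ mapColumn j₀ g T i j) → Step T T'

  _∼c_ : Tableau A n → Tableau A n → Set
  T ∼c T' = Star Step T T'

-- Each elementary operation changes the tableau by T'(i, j) = φⱼ (T (ρ i) (σ j)) for permutations
-- ρ, σ and bijections φⱼ of the alphabet.  The word map w ↦ (j ↦ φⱼ (w (σ j))) is then injective
-- and sends the row words of T onto those of T' (reindexed by ρ) and the diagonal words of T onto
-- those of T' (a diagonal π of T corresponds to the diagonal ρ⁻¹ ∘ π ∘ σ of T'), so it is an
-- isomorphism of colored hypergraphs; isomorphisms compose along the chain of operations.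
module Submission where

open import Defs
open import Data.Nat using (ℕ; _≤_)
open import Data.Fin using (Fin; _≟_)
open import Data.Fin.Permutation
  using (Permutation′; _⟨$⟩ʳ_; _⟨$⟩ˡ_; _∘ₚ_; id; flip; inverseˡ; inverseʳ)
open import Data.Vec using (Vec; tabulate; lookup)
open import Data.Vec.Properties using (tabulate-cong; lookup∘tabulate; tabulate∘lookup)
open import Data.Product using (∃-syntax; _×_; _,_)
open import Data.Sum using (inj₁; inj₂)
open import Function using (_∘_)
open import Function.Bundles using (_↔_; Inverse)
open import Function.Construct.Identity using (↔-id)
open import Relation.Nullary using (yes; no)
open import Relation.Binary.PropositionalEquality
open import Relation.Binary.Construct.Closure.ReflexiveTransitive using (ε; _◅_)

open Inverse using (to; from)

MapsOnto : {X : Set} → (X → Set) → (X → Set) → (X → X) → Set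
MapsOnto {X} P Q f = (∀ w → P w → Q (f w)) × (∀ w′ → Q w′ → ∃[ w ] (P w × f w ≡ w′))

mapsOnto-images : {X I J : Set} {u : I → X} {v : J → X} {f : X → X} →
  (∀ i → ∃[ j ] f (u i) ≡ v j) → (∀ j → ∃[ i ] v j ≡ f (u i)) →
  MapsOnto (λ w → ∃[ i ] u i ≡ w) (λ w → ∃[ j ] v j ≡ w) f
mapsOnto-images {u = u} {f = f} fwd bwd =
  (λ { w (i , refl) → let (j , e) = fwd i in j , sym e })
  , (λ { w′ (j , refl) → let (i , e) = bwd j in u i , (i , refl) , sym e })

module _ {A : Set} {n : ℕ} where

  coloredIso-refl : (T : Tableau A n) → ColoredIso T T
  coloredIso-refl T =
    (λ w → w) , (λ _ x → x) , (λ _ _ _ _ e → e) , (λ w′ x → w′ , x , refl)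
    , (λ _ x → x) , (λ w′ x → w′ , x , refl)

  coloredIso-trans : {T₁ T₂ T₃ : Tableau A n} →
    ColoredIso T₁ T₂ → ColoredIso T₂ T₃ → ColoredIso T₁ T₃
  coloredIso-trans (f , fU , f-inj , f-ontoU , fI , f-ontoI) (g , gU , g-inj , g-ontoU , gI , g-ontoI) =
    g ∘ f
    , (λ w x → gU (f w) (fU w x))
    , (λ w v x y e → f-inj w v x y (g-inj (f w) (f v) (fU w x) (fU v y) e))
    , (λ w″ x → let (w′ , x′ , e′) = g-ontoU w″ x ; (w , x₀ , e) = f-ontoU w′ x′
                in w , x₀ , trans (cong g e) e′)
    , (λ w x → gI (f w) (fI w x))
    , (λ w″ x → let (w′ , x′ , e′) = g-ontoI w″ x ; (w , x₀ , e) = f-ontoI w′ x′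
                in w , x₀ , trans (cong g e) e′)

  coloredIso-fromInjection : {T T′ : Tableau A n} (f h : Vec A n → Vec A n) →
    (∀ w → h (f w) ≡ w) →
    MapsOnto (InL T) (InL T′) f → MapsOnto (InP T) (InP T′) f → ColoredIso T T′
  coloredIso-fromInjection {T} {T′} f h h∘f (fL , f-ontoL) (fP , f-ontoP) =
    f , fU , (λ w v _ _ → injective) , f-ontoU , fI , f-ontoI
    where
    injective : ∀ {w v} → f w ≡ f v → w ≡ v
    injective {w} {v} e = trans (sym (h∘f w)) (trans (cong h e) (h∘f v))

    fU : ∀ w → InU T w → InU T′ (f w)
    fU w (inj₁ x) = inj₁ (fL w x)
    fU w (inj₂ x) = inj₂ (fP w x)

    f-ontoU : ∀ w′ → InU T′ w′ → ∃[ w ] (InU T w × f w ≡ w′)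
    f-ontoU w′ (inj₁ x) = let (w , y , e) = f-ontoL w′ x in w , inj₁ y , e
    f-ontoU w′ (inj₂ x) = let (w , y , e) = f-ontoP w′ x in w , inj₂ y , e

    fI : ∀ w → InI T w → InI T′ (f w)
    fI w (x , y) = fL w x , fP w y

    -- the preimages of w′ as a row word and as a diagonal word coincide by injectivity
    f-ontoI : ∀ w′ → InI T′ w′ → ∃[ w ] (InI T w × f w ≡ w′)
    f-ontoI w′ (x , y) with f-ontoL w′ x | f-ontoP w′ y
    ... | w , wL , e | v , vP , e′ =
      w , (wL , subst (InP T) (injective (trans e′ (sym e))) vP) , e

  coloredIso-relabel : {T T′ : Tableau A n} (ρ σ : Permutation′ n) (φ : Fin n → A ↔ A) →
    (∀ i j → T′ i j ≡ to (φ j) (T (ρ ⟨$⟩ʳ i) (σ ⟨$⟩ʳ j))) → ColoredIso T T′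
  coloredIso-relabel {T} {T′} ρ σ φ T′≡ =
    coloredIso-fromInjection f h h∘f
      (mapsOnto-images (λ i → ρ ⟨$⟩ˡ i , sym (row-image (inverseʳ ρ)))
                       (λ i → ρ ⟨$⟩ʳ i , row-image refl))
      (mapsOnto-images (λ π → σ ∘ₚ π ∘ₚ flip ρ , sym (diag-image π (σ ∘ₚ π ∘ₚ flip ρ) (λ _ → inverseʳ ρ)))
                       (λ π → flip σ ∘ₚ π ∘ₚ ρ , diag-image (flip σ ∘ₚ π ∘ₚ ρ) π
                         (λ _ → sym (cong (λ k → ρ ⟨$⟩ʳ (π ⟨$⟩ʳ k)) (inverseˡ σ)))))
    where
    f h : Vec A n → Vec A n
    f w = tabulate (λ j → to (φ j) (lookup w (σ ⟨$⟩ʳ j)))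
    h w = tabulate (λ j → from (φ (σ ⟨$⟩ˡ j)) (lookup w (σ ⟨$⟩ˡ j)))

    h∘f : ∀ w → h (f w) ≡ w
    h∘f w = trans (tabulate-cong λ j → begin
        from (φ (σ ⟨$⟩ˡ j)) (lookup (f w) (σ ⟨$⟩ˡ j))
          ≡⟨ cong (from (φ (σ ⟨$⟩ˡ j))) (lookup∘tabulate _ (σ ⟨$⟩ˡ j)) ⟩
        from (φ (σ ⟨$⟩ˡ j)) (to (φ (σ ⟨$⟩ˡ j)) (lookup w (σ ⟨$⟩ʳ (σ ⟨$⟩ˡ j))))
          ≡⟨ Inverse.inverseʳ (φ (σ ⟨$⟩ˡ j)) refl ⟩
        lookup w (σ ⟨$⟩ʳ (σ ⟨$⟩ˡ j))
          ≡⟨ cong (lookup w) (inverseʳ σ) ⟩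
        lookup w j ∎)
      (tabulate∘lookup w)
      where open ≡-Reasoning

    f-tabulate : ∀ g → f (tabulate g) ≡ tabulate (λ j → to (φ j) (g (σ ⟨$⟩ʳ j)))
    f-tabulate g = tabulate-cong (λ j → cong (to (φ j)) (lookup∘tabulate g (σ ⟨$⟩ʳ j)))

    row-image : ∀ {i i′} → ρ ⟨$⟩ʳ i′ ≡ i → rowWord T′ i′ ≡ f (rowWord T i)
    row-image {i} {i′} ρi′≡i = trans
      (tabulate-cong (λ j → trans (T′≡ i′ j) (cong (λ k → to (φ j) (T k (σ ⟨$⟩ʳ j))) ρi′≡i)))
      (sym (f-tabulate (T i)))

    diag-image : ∀ π π′ → (∀ i → ρ ⟨$⟩ʳ (π′ ⟨$⟩ʳ i) ≡ π ⟨$⟩ʳ (σ ⟨$⟩ʳ i)) →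
      diagWord T′ π′ ≡ f (diagWord T π)
    diag-image π π′ commutes = trans
      (tabulate-cong (λ i → trans (T′≡ (π′ ⟨$⟩ʳ i) i)
        (cong (λ k → to (φ i) (T k (σ ⟨$⟩ʳ i))) (commutes i))))
      (sym (f-tabulate (λ k → T (π ⟨$⟩ʳ k) k)))

  relabelColumn : Fin n → A ↔ A → Fin n → A ↔ A
  relabelColumn j₀ g j with j ≟ j₀
  ... | yes _ = g
  ... | no _  = ↔-id A

  mapColumn-relabel : ∀ j₀ g (T : Tableau A n) i j →
    mapColumn j₀ g T i j ≡ to (relabelColumn j₀ g j) (T i j)
  mapColumn-relabel j₀ g T i j with j ≟ j₀
  ... | yes _ = refl
  ... | no _  = refl

  step-coloredIso : {T T′ : Tableau A n} → Step T T′ → ColoredIso T T′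
  step-coloredIso (permRows σ p) = coloredIso-relabel σ id (λ _ → ↔-id A) p
  step-coloredIso (permCols σ p) = coloredIso-relabel id σ (λ _ → ↔-id A) p
  step-coloredIso {T} (colBij j₀ g p) =
    coloredIso-relabel id id (relabelColumn j₀ g) (λ i j → trans (p i j) (mapColumn-relabel j₀ g T i j))

  ∼c⇒coloredIso : {T T′ : Tableau A n} → T ∼c T′ → ColoredIso T T′
  ∼c⇒coloredIso ε       = coloredIso-refl _
  ∼c⇒coloredIso (s ◅ r) = coloredIso-trans (step-coloredIso s) (∼c⇒coloredIso r)

mainTheorem8 : (A : Set) → IsFinite A → (n : ℕ) → 1 ≤ n →
    (T T' : Tableau A n) → T ∼c T' → ColoredIso T T'
mainTheorem8 A _ n _ T T' = ∼c⇒coloredIso
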